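{- Let $\hat G$ be a looping of a finite simple graph $G$, let $\mathcal A$ be the zero-nonzero pattern of the (looped) adjacency matrix of $\hat G$, and let $R$ and $C$ be subsets of $V(G)$ with $|R|=|C|$. Then $\mathcal A[R,C]$ is a triangle if and only if $V(G)\setminus C$ is a loop zero forcing set for $\hat G$ from which $R$ can be the set of vertices that force.
   Context: A zero-nonzero pattern is a matrix with entries in $\{0,*\}$; a square pattern is a triangle if some permutation of its rows followed by some independent permutation of its columns yields a lower-triangular pattern with only $*$ entries on its diagonal. $\mathcal A[R,C]$ denotes the submatrix with rows indexed by $R$ and columns by $C$. A looping of $G$ is a loop graph obtained by adding loops to some vertices of $G$; the pattern of its looped adjacency matrix has $(i,j)$ entry $*$ iff $i,j$ are adjacent (for $i\ne j$) and diagonal entry $(i,i)$ equal to $*$ iff $i$ has a loop. Loop zero forcing rule: with some vertices filled, any vertex $v$ (filled or not) may force (fill) $u$ if $u$ is the unique unfilled neighbor of $v$ (a looped vertex is its own neighbor); each vertex forces at most once. A forcing sequence from $F$ is a sequence of forces each allowed by the rule when starting with $F$ filled and after the preceding forces have occurred; it is complete if no further force is possible afterwards. $F$ is a loop zero forcing set if repeated forcing fills all vertices. "$F$ is a loop zero forcing set from which $R$ can be the set of vertices that force" means $F$ is a loop zero forcing set and there is a complete forcing sequence from $F$ in which the set of vertices that force is exactly $R$. -}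

module Defs where

open import Data.Nat using (ℕ)
open import Data.Bool using (Bool; true; false)
open import Data.Fin using (Fin; _<_; _≟_)
open import Data.Fin.Subset using (Subset; _∈_; _∉_; ∁)
open import Data.Fin.Subset.Properties using (_∈?_)
open import Data.Fin.Permutation using (Permutation; Permutation′; _⟨$⟩ʳ_)
open import Data.List using (List; []; _∷_; map; filter; length; lookup; allFin)
open import Data.List.Membership.Propositional renaming (_∈_ to _∈L_; _∉_ to _∉L_)
open import Data.Product using (Σ; ∃; ∃-syntax; _×_; _,_; proj₁; proj₂)
open import Data.Sum using (_⊎_)
open import Function.Bundles using (_⇔_)
open import Relation.Nullary using (¬_; yes; no)
open import Relation.Binary.PropositionalEquality using (_≡_; _≢_)

record SimpleGraph (n : ℕ) : Set where
  field
    adj    : Fin n → Fin n → Bool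
    sym    : ∀ i j → adj i j ≡ adj j i
    irrefl : ∀ i → adj i i ≡ false
open SimpleGraph public

-- A zero-nonzero pattern with rows indexed by Fin a, columns by Fin b.
-- true = *, false = 0.
Pattern : ℕ → ℕ → Set
Pattern a b = Fin a → Fin b → Bool

-- A looping of G is given by the set of looped vertices  loops : Fin n → Bool.
-- Zero-nonzero pattern of the looped adjacency matrix.
loopedPattern : ∀ {n} → SimpleGraph n → (Fin n → Bool) → Pattern n n
loopedPattern G loops i j with i ≟ j
... | yes _ = loops i
... | no _  = adj G i j

elems : ∀ {n} → Subset n → List (Fin n)
elems R = filter (λ i → i ∈? R) (allFin _)

submatrix : ∀ {n} → Pattern n n → (R C : Subset n) →
            Pattern (length (elems R)) (length (elems C))
submatrix A R C i j = A (lookup (elems R) i) (lookup (elems C) j)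

-- A pattern is a triangle: it is square (witnessed by the bijection τ between
-- Fin a and Fin b), and after permuting rows by σ and columns by τ it is
-- lower triangular with only * entries on the diagonal.
IsTriangle : ∀ {a b} → Pattern a b → Set
IsTriangle {a} {b} M =
  Σ (Permutation′ a) λ σ → Σ (Permutation a b) λ τ →
    (∀ i → M (σ ⟨$⟩ʳ i) (τ ⟨$⟩ʳ i) ≡ true) ×
    (∀ i j → i < j → M (σ ⟨$⟩ʳ i) (τ ⟨$⟩ʳ j) ≡ false)

-- Loop zero forcing.  A forcing sequence is a list of forces (v , u)
-- ("v forces u"), stored MOST RECENT FIRST.

Force : ℕ → Set
Force n = Fin n × Fin n

Filled : ∀ {n} → Subset n → List (Force n) → Fin n → Set
Filled F done w = w ∈ F ⊎ w ∈L map proj₂ done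

-- v may force u (v filled or not): v has not forced yet, u is unfilled,
-- u is a neighbor of v (a looped vertex is its own neighbor), and every
-- other neighbor of v is filled.
CanForce : ∀ {n} → Pattern n n → Subset n → List (Force n) → Fin n → Fin n → Set
CanForce A F done v u =
  (v ∉L map proj₁ done) × ¬ Filled F done u × (A v u ≡ true) ×
  (∀ w → A v w ≡ true → w ≢ u → Filled F done w)

data ForcingSeq {n} (A : Pattern n n) (F : Subset n) : List (Force n) → Set where
  []   : ForcingSeq A F []
  step : ∀ {done v u} → ForcingSeq A F done → CanForce A F done v u →
         ForcingSeq A F ((v , u) ∷ done)

Complete : ∀ {n} → Pattern n n → Subset n → List (Force n) → Set
Complete A F done = ∀ v u → ¬ CanForce A F done v u

IsLoopZFS : ∀ {n} → Pattern n n → Subset n → Set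
IsLoopZFS A F = ∃[ done ] (ForcingSeq A F done × (∀ w → Filled F done w))

LoopZFSWithForcers : ∀ {n} → Pattern n n → Subset n → Subset n → Set
LoopZFSWithForcers A F R =
  IsLoopZFS A F ×
  ∃[ done ] (ForcingSeq A F done × Complete A F done ×
             (∀ v → (v ∈ R) ⇔ (v ∈L map proj₁ done)))

{-# OPTIONS --safe #-}
module Submission where

-- Both sides amount to a list of forces (r , c), most recent first, that lists R and C once each,
-- with A r c = * for every entry and A r′ c = 0 whenever (r′ , c′) comes later in the list.
-- Read from its end, such a list orders the rows and columns of A[R,C] into a triangle; it is
-- also a forcing sequence from V ∖ C, since every neighbour of r other than c lies outside C or
-- was forced before c.  Conversely, a vertex that has forced has all its neighbours filled, so it
-- is not adjacent to any vertex forced later; and a complete forcing sequence fills everything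
-- that any forcing sequence fills, so from a zero forcing set it forces exactly C.  Neither the
-- symmetry of the adjacency pattern nor the choice of loops plays a role.

open import Defs hiding (sym)
open import Data.Nat using (ℕ; s≤s)
open import Data.Nat.Properties using (∸-monoʳ-<)
open import Data.Bool using (Bool; true; false)
open import Data.Bool.Properties using (¬-not; not-¬)
open import Data.Fin using (Fin; zero; suc; _<_; _≟_; opposite)
open import Data.Fin.Properties using (opposite-prop; toℕ<n; <⇒≢)
open import Data.Fin.Subset using (Subset; ∣_∣; _∈_; _∉_; ∁)
open import Data.Fin.Subset.Properties using (_∈?_; x∈∁p⇒x∉p; x∉∁p⇒x∈p; x∉p⇒x∈∁p)
open import Data.Fin.Permutation
  using (Permutation; _⟨$⟩ʳ_; _⟨$⟩ˡ_; permutation; inverseʳ; ↔⇒≡; reverse; _∘ₚ_)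
open import Data.List using (List; []; _∷_; map; length; lookup; allFin; tabulate)
open import Data.List.Properties using (map-tabulate)
open import Data.List.Membership.Propositional using () renaming (_∈_ to _∈L_; _∉_ to _∉L_)
open import Data.List.Membership.Propositional.Properties
  using (∈-map⁺; ∈-map⁻; ∈-lookup; ∈-allFin; ∈-filter⁺; ∈-filter⁻; ∈-tabulate⁺; ∈-tabulate⁻)
open import Data.List.Relation.Unary.Any using (here; there; index)
open import Data.List.Relation.Unary.Any.Properties using (lookup-index)
import Data.List.Relation.Unary.Any.Properties as Any
open import Data.List.Relation.Unary.All using (All; []; _∷_)
import Data.List.Relation.Unary.All as All
open import Data.List.Relation.Unary.All.Properties using (All¬⇒¬Any) renaming (tabulate⁺ to All-tabulate⁺)
open import Data.List.Relation.Unary.AllPairs using (AllPairs; []; _∷_)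
import Data.List.Relation.Unary.AllPairs as AllPairs
open import Data.List.Relation.Unary.AllPairs.Properties using (tabulate⁺-<)
open import Data.List.Relation.Unary.Unique.Propositional using (Unique)
open import Data.List.Relation.Unary.Unique.Propositional.Properties using (allFin⁺; filter⁺)
open import Data.Product using (Σ; ∃; _×_; _,_; proj₁; proj₂; uncurry)
open import Data.Sum using (inj₁; inj₂; [_,_])
open import Data.Empty using (⊥-elim)
open import Function using (id; _∘_; _on_)
open import Function.Bundles using (_⇔_; mk⇔; Equivalence; Injection)
open import Function.Properties.Inverse using (Inverse⇒Injection)
open import Function.Properties.Equivalence using () renaming (sym to ⇔-sym; trans to ⇔-trans)
open import Relation.Nullary using (¬_; Dec; yes; no)
open import Relation.Binary.PropositionalEquality
  using (_≡_; _≢_; refl; sym; trans; cong; cong₂; subst)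

private
  variable
    X Y : Set

lookup-injective : (g : X → Y) {xs : List X} → AllPairs (_≢_ on g) xs →
                   ∀ i j → g (lookup xs i) ≡ g (lookup xs j) → i ≡ j
lookup-injective g {_ ∷ _} (_ ∷ _) zero zero _ = refl
lookup-injective g {_ ∷ _} (gx≢ ∷ _) zero (suc j) eq = ⊥-elim (All.lookup gx≢ (∈-lookup j) eq)
lookup-injective g {_ ∷ _} (gx≢ ∷ _) (suc i) zero eq = ⊥-elim (All.lookup gx≢ (∈-lookup i) (sym eq))
lookup-injective g {_ ∷ _} (_ ∷ g-inj) (suc i) (suc j) eq = cong suc (lookup-injective g g-inj i j eq)

index-permutation : (g : X → Y) {xs : List X} {ys : List Y} →
  AllPairs (_≢_ on g) xs → Unique ys → (∀ y → y ∈L map g xs ⇔ y ∈L ys) →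
  Σ (Permutation (length xs) (length ys)) λ π → ∀ k → lookup ys (π ⟨$⟩ʳ k) ≡ g (lookup xs k)
index-permutation g {xs} {ys} g-inj ys-unique same = permutation to from to∘from from∘to , to-lookup
  where
  to : Fin (length xs) → Fin (length ys)
  to k = index (Equivalence.to (same _) (∈-map⁺ g (∈-lookup k)))
  from : Fin (length ys) → Fin (length xs)
  from j = index (Any.map⁻ (Equivalence.from (same _) (∈-lookup j)))
  to-lookup : ∀ k → lookup ys (to k) ≡ g (lookup xs k)
  to-lookup k = sym (lookup-index (Equivalence.to (same _) (∈-map⁺ g (∈-lookup k))))
  from-lookup : ∀ j → g (lookup xs (from j)) ≡ lookup ys j
  from-lookup j = sym (lookup-index (Any.map⁻ (Equivalence.from (same _) (∈-lookup j))))
  to∘from : ∀ j → to (from j) ≡ j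
  to∘from j = lookup-injective id ys-unique _ _ (trans (to-lookup (from j)) (from-lookup j))
  from∘to : ∀ k → from (to k) ≡ k
  from∘to k = lookup-injective g g-inj _ _ (trans (from-lookup (to k)) (to-lookup k))

AllPairs-lookup : ∀ {R : X → X → Set} {xs : List X} → AllPairs R xs →
                  ∀ {i j} → i < j → R (lookup xs i) (lookup xs j)
AllPairs-lookup {xs = _ ∷ _} (Rx ∷ _) {zero} {suc j} _ = All.lookup Rx (∈-lookup j)
AllPairs-lookup {xs = _ ∷ _} (_ ∷ R-xs) {suc i} {suc j} (s≤s i<j) = AllPairs-lookup R-xs i<j

opposite-< : ∀ {m} {i j : Fin m} → i < j → opposite j < opposite i
opposite-< {i = i} {j} i<j rewrite opposite-prop i | opposite-prop j = ∸-monoʳ-< (s≤s i<j) (toℕ<n j)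

reversal : ∀ {m n} → m ≡ n → Σ (Permutation m n) λ ψ → ∀ {i j} → i < j → ψ ⟨$⟩ʳ j < ψ ⟨$⟩ʳ i
reversal refl = reverse , opposite-<

lookup∘permutation-injective : ∀ {m} {xs : List X} → Unique xs → (π : Permutation m (length xs)) →
                               ∀ {i j} → lookup xs (π ⟨$⟩ʳ i) ≡ lookup xs (π ⟨$⟩ʳ j) → i ≡ j
lookup∘permutation-injective xs-unique π =
  Injection.injective (Inverse⇒Injection π) ∘ lookup-injective id xs-unique _ _

Enumerates : ∀ {n} → Subset n → List (Fin n) → Set
Enumerates S xs = ∀ v → v ∈ S ⇔ v ∈L xs

elems-enumerates : ∀ {n} (S : Subset n) → Enumerates S (elems S)
elems-enumerates S v = mk⇔ (∈-filter⁺ (_∈? S) (∈-allFin v)) (proj₂ ∘ ∈-filter⁻ (_∈? S) {xs = allFin _})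

elems-unique : ∀ {n} (S : Subset n) → Unique (elems S)
elems-unique {n} S = filter⁺ (_∈? S) (allFin⁺ n)

enumerates-permuted : ∀ {m n} {S : Subset n} {xs} → Enumerates S xs → (π : Permutation m (length xs)) →
                      Enumerates S (tabulate (λ p → lookup xs (π ⟨$⟩ʳ p)))
enumerates-permuted {xs = xs} enum π v = ⇔-trans (enum v) (mk⇔ to from)
  where
  to : v ∈L xs → v ∈L tabulate (λ p → lookup xs (π ⟨$⟩ʳ p))
  to v∈ = subst (_∈L _) (trans (cong (lookup xs) (inverseʳ π)) (sym (lookup-index v∈)))
                (∈-tabulate⁺ (π ⟨$⟩ˡ index v∈))
  from : v ∈L tabulate (λ p → lookup xs (π ⟨$⟩ʳ p)) → v ∈L xs
  from v∈ with p , refl ← ∈-tabulate⁻ v∈ = ∈-lookup (π ⟨$⟩ʳ p)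

record Follows {n} (A : Pattern n n) (new old : Force n) : Set where
  field
    forcer≢     : proj₁ new ≢ proj₁ old
    forced≢     : proj₂ new ≢ proj₂ old
    nonadjacent : A (proj₁ old) (proj₂ new) ≡ false

record Schedule {n} (A : Pattern n n) (R C : Subset n) (ds : List (Force n)) : Set where
  field
    follows : AllPairs (Follows A) ds
    nonzero : All (λ f → uncurry A f ≡ true) ds
    forcers : Enumerates R (map proj₁ ds)
    forced  : Enumerates C (map proj₂ ds)

module _ {n} (A : Pattern n n) (R C : Subset n) where

  triangle⇒schedule : IsTriangle (submatrix A R C) → ∃ (Schedule A R C)
  triangle⇒schedule (σ , τ , diagonal , upper) = tabulate force , record
    { follows = tabulate⁺-< λ p<q → record
      { forcer≢     = <⇒≢ p<q ∘ lookup∘permutation-injective (elems-unique R) ρ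
      ; forced≢     = <⇒≢ p<q ∘ lookup∘permutation-injective (elems-unique C) κ
      ; nonadjacent = upper _ _ (opposite-< p<q)
      }
    ; nonzero = All-tabulate⁺ (diagonal ∘ opposite)
    ; forcers = subst (Enumerates R) (sym (map-tabulate force proj₁))
                      (enumerates-permuted (elems-enumerates R) ρ)
    ; forced  = subst (Enumerates C) (sym (map-tabulate force proj₂))
                      (enumerates-permuted (elems-enumerates C) κ)
    }
    where
    ρ = reverse ∘ₚ σ
    κ = reverse ∘ₚ τ
    force : Fin (length (elems R)) → Force n
    force p = lookup (elems R) (ρ ⟨$⟩ʳ p) , lookup (elems C) (κ ⟨$⟩ʳ p)

  schedule⇒triangle : ∃ (Schedule A R C) → IsTriangle (submatrix A R C)
  schedule⇒triangle (ds , s) = ψ ∘ₚ ρ , ψ ∘ₚ κ , diagonal , upper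
    where
    open Schedule s
    ρ-spec = index-permutation proj₁ (AllPairs.map Follows.forcer≢ follows) (elems-unique R)
               (λ v → ⇔-trans (⇔-sym (forcers v)) (elems-enumerates R v))
    κ-spec = index-permutation proj₂ (AllPairs.map Follows.forced≢ follows) (elems-unique C)
               (λ v → ⇔-trans (⇔-sym (forced v)) (elems-enumerates C v))
    ρ = proj₁ ρ-spec
    κ = proj₁ κ-spec
    ψ-spec = reversal (sym (↔⇒≡ ρ))
    ψ = proj₁ ψ-spec
    entry : ∀ k l → submatrix A R C (ρ ⟨$⟩ʳ k) (κ ⟨$⟩ʳ l) ≡ A (proj₁ (lookup ds k)) (proj₂ (lookup ds l))
    entry k l = cong₂ A (proj₂ ρ-spec k) (proj₂ κ-spec l)
    diagonal : ∀ i → submatrix A R C ((ψ ∘ₚ ρ) ⟨$⟩ʳ i) ((ψ ∘ₚ κ) ⟨$⟩ʳ i) ≡ true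
    diagonal i = trans (entry _ _) (All.lookup nonzero (∈-lookup (ψ ⟨$⟩ʳ i)))
    upper : ∀ i j → i < j → submatrix A R C ((ψ ∘ₚ ρ) ⟨$⟩ʳ i) ((ψ ∘ₚ κ) ⟨$⟩ʳ j) ≡ false
    upper i j i<j = trans (entry _ _) (Follows.nonadjacent (AllPairs-lookup follows (proj₂ ψ-spec i<j)))

  triangle⇔schedule : IsTriangle (submatrix A R C) ⇔ ∃ (Schedule A R C)
  triangle⇔schedule = mk⇔ triangle⇒schedule schedule⇒triangle

∉-map : ∀ {g : X → Y} {x : Y} {ys : List X} → All (λ y → x ≢ g y) ys → x ∉L map g ys
∉-map x≢ = All¬⇒¬Any x≢ ∘ Any.map⁻

module Forcing {n} (A : Pattern n n) (F : Subset n) where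
  open import Data.List.Membership.DecPropositional (_≟_ {n}) using () renaming (_∈?_ to _∈L?_)

  Legal : Force n → Set
  Legal f = uncurry A f ≡ true × proj₂ f ∉ F

  Filled-∷ : ∀ {ds w} f → Filled F ds w → Filled F (f ∷ ds) w
  Filled-∷ _ (inj₁ w∈F)  = inj₁ w∈F
  Filled-∷ _ (inj₂ w∈ds) = inj₂ (there w∈ds)

  Filled-∷⁻ : ∀ {ds w} f → Filled F (f ∷ ds) w → w ≢ proj₂ f → Filled F ds w
  Filled-∷⁻ _ (inj₁ w∈F)          _   = inj₁ w∈F
  Filled-∷⁻ _ (inj₂ (here refl))  w≢u = ⊥-elim (w≢u refl)
  Filled-∷⁻ _ (inj₂ (there w∈ds)) _   = inj₂ w∈ds

  filled? : ∀ ds w → Dec (Filled F ds w)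
  filled? ds w with w ∈? F | w ∈L? map proj₂ ds
  ... | yes w∈F | _        = yes (inj₁ w∈F)
  ... | no _    | yes w∈ds = yes (inj₂ w∈ds)
  ... | no w∉F  | no w∉ds  = no [ w∉F , w∉ds ]

  forcer-neighbours-filled : ∀ {ds} → ForcingSeq A F ds → ∀ {v} → v ∈L map proj₁ ds →
                             ∀ {w} → A v w ≡ true → Filled F ds w
  forcer-neighbours-filled (step {v = v} {u} _ (_ , _ , _ , others)) (here refl) {w} a with w ≟ u
  ... | yes refl = inj₂ (here refl)
  ... | no w≢u   = Filled-∷ (v , u) (others w a w≢u)
  forcer-neighbours-filled (step {v = v} {u} fs _) (there v∈) a =
    Filled-∷ (v , u) (forcer-neighbours-filled fs v∈ a)

  -- If u, forced by v in es, were unfilled after ds, then v could still force u: its other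
  -- neighbours are filled after ds by induction, and v has not forced in ds, since otherwise
  -- all its neighbours, u included, would be filled.
  complete-maximal : ∀ {ds} → ForcingSeq A F ds → Complete A F ds →
                     ∀ {es} → ForcingSeq A F es → ∀ {w} → Filled F es w → Filled F ds w
  complete-maximal _ _ _ (inj₁ w∈F) = inj₁ w∈F
  complete-maximal fs comp (step es _) (inj₂ (there w∈es)) = complete-maximal fs comp es (inj₂ w∈es)
  complete-maximal {ds} fs comp (step {v = v} {u} es (_ , _ , a , others)) (inj₂ (here refl))
    with filled? ds u
  ... | yes u-filled  = u-filled
  ... | no u-unfilled = ⊥-elim (comp v u (v-fresh , u-unfilled , a , others-filled))
    where
    v-fresh : v ∉L map proj₁ ds
    v-fresh v∈ = u-unfilled (forcer-neighbours-filled fs v∈ a)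
    others-filled : ∀ w → A v w ≡ true → w ≢ u → Filled F ds w
    others-filled w a′ w≢u = complete-maximal fs comp es (others w a′ w≢u)

  forcingSeq⇒legal : ∀ {ds} → ForcingSeq A F ds → All Legal ds
  forcingSeq⇒legal [] = []
  forcingSeq⇒legal (step fs (_ , u-unfilled , a , _)) = (a , u-unfilled ∘ inj₁) ∷ forcingSeq⇒legal fs

  forcingSeq⇒follows : ∀ {ds} → ForcingSeq A F ds → AllPairs (Follows A) ds
  forcingSeq⇒follows [] = []
  forcingSeq⇒follows (step {done} {v} {u} fs (v-fresh , u-unfilled , _ , _)) =
    All.tabulate follows-old ∷ forcingSeq⇒follows fs
    where
    follows-old : ∀ {old} → old ∈L done → Follows A (v , u) old
    follows-old old∈ = record
      { forcer≢     = λ { refl → v-fresh (∈-map⁺ proj₁ old∈) }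
      ; forced≢     = λ { refl → u-unfilled (inj₂ (∈-map⁺ proj₂ old∈)) }
      ; nonadjacent = ¬-not (u-unfilled ∘ forcer-neighbours-filled fs (∈-map⁺ proj₁ old∈))
      }

  follows⇒forcingSeq : ∀ {ds} → AllPairs (Follows A) ds → All Legal ds →
                       (∀ {v u} → (v , u) ∈L ds → ∀ w → A v w ≡ true → Filled F ds w) →
                       ForcingSeq A F ds
  follows⇒forcingSeq [] [] _ = []
  follows⇒forcingSeq {(v , u) ∷ ds} (follows-old ∷ fol) ((a , u∉F) ∷ legal) neighbours-filled =
    step (follows⇒forcingSeq fol legal neighbours-filled′) (v-fresh , u-unfilled , a , others-filled)
    where
    v-fresh : v ∉L map proj₁ ds
    v-fresh = ∉-map (All.map Follows.forcer≢ follows-old)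
    u-unfilled : ¬ Filled F ds u
    u-unfilled = [ u∉F , ∉-map (All.map Follows.forced≢ follows-old) ]
    others-filled : ∀ w → A v w ≡ true → w ≢ u → Filled F ds w
    others-filled w a′ = Filled-∷⁻ (v , u) (neighbours-filled (here refl) w a′)
    neighbours-filled′ : ∀ {v′ u′} → (v′ , u′) ∈L ds → ∀ w → A v′ w ≡ true → Filled F ds w
    neighbours-filled′ old∈ w a′ = Filled-∷⁻ (v , u) (neighbours-filled (there old∈) w a′)
      λ { refl → not-¬ a′ (Follows.nonadjacent (All.lookup follows-old old∈)) }

module _ {n} (A : Pattern n n) (R C : Subset n) where
  open Forcing A (∁ C)

  loopZFS⇒schedule : LoopZFSWithForcers A (∁ C) R → ∃ (Schedule A R C)
  loopZFS⇒schedule ((es , es-seq , es-fills) , ds , ds-seq , ds-complete , forcers) = ds , record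
    { follows = forcingSeq⇒follows ds-seq
    ; nonzero = All.map proj₁ legal
    ; forcers = forcers
    ; forced  = λ w → mk⇔ C⊆forced forced⊆C
    }
    where
    legal : All Legal ds
    legal = forcingSeq⇒legal ds-seq
    C⊆forced : ∀ {w} → w ∈ C → w ∈L map proj₂ ds
    C⊆forced {w} w∈C with complete-maximal ds-seq ds-complete es-seq (es-fills w)
    ... | inj₁ w∈∁C = ⊥-elim (x∈∁p⇒x∉p w∈∁C w∈C)
    ... | inj₂ w∈ds = w∈ds
    forced⊆C : ∀ {w} → w ∈L map proj₂ ds → w ∈ C
    forced⊆C w∈ds with f , f∈ds , refl ← ∈-map⁻ proj₂ w∈ds = x∉∁p⇒x∈p (proj₂ (All.lookup legal f∈ds))

  schedule⇒loopZFS : ∃ (Schedule A R C) → LoopZFSWithForcers A (∁ C) R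
  schedule⇒loopZFS (ds , s) = (ds , ds-seq , all-filled) , ds , ds-seq , complete , forcers
    where
    open Schedule s
    all-filled : ∀ w → Filled (∁ C) ds w
    all-filled w with w ∈? C
    ... | yes w∈C = inj₂ (Equivalence.to (forced w) w∈C)
    ... | no w∉C  = inj₁ (x∉p⇒x∈∁p w∉C)
    initially-unfilled : ∀ {f} → f ∈L ds → proj₂ f ∉ ∁ C
    initially-unfilled f∈ds f∈∁C = x∈∁p⇒x∉p f∈∁C (Equivalence.from (forced _) (∈-map⁺ proj₂ f∈ds))
    ds-seq : ForcingSeq A (∁ C) ds
    ds-seq = follows⇒forcingSeq follows (All.zip (nonzero , All.tabulate initially-unfilled))
                                (λ _ w _ → all-filled w)
    complete : Complete A (∁ C) ds
    complete _ u (_ , u-unfilled , _) = u-unfilled (all-filled u)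

  loopZFS⇔schedule : LoopZFSWithForcers A (∁ C) R ⇔ ∃ (Schedule A R C)
  loopZFS⇔schedule = mk⇔ loopZFS⇒schedule schedule⇒loopZFS

-- The hypothesis |R| = |C| is redundant: both sides imply it.
theorem2p3 : (n : ℕ) (G : SimpleGraph n) (loops : Fin n → Bool) (R C : Subset n) →
    ∣ R ∣ ≡ ∣ C ∣ →
    IsTriangle (submatrix (loopedPattern G loops) R C) ⇔
      LoopZFSWithForcers (loopedPattern G loops) (∁ C) R
theorem2p3 n G loops R C _ = ⇔-trans (triangle⇔schedule A R C) (⇔-sym (loopZFS⇔schedule A R C))
  where
  A : Pattern n n
  A = loopedPattern G loops
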